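{- Let $I$ be an independent set in a claw-free graph $G$ and let $C$ be an $I$-bad cycle. If $C$ is resolvable with respect to $I$, then $I\leftrightarrow_{\mathrm{TS}} I\Delta V(C)$.
   Context: Graphs are finite and simple; claw-free means no induced $K_{1,3}$. A TS-sequence is a sequence $I_0,\ldots,I_m$ of independent sets such that each $I_{i+1}$ arises from $I_i$ by a move $u\to v$: $uv\in E(G)$, $I_i\setminus I_{i+1}=\{u\}$, $I_{i+1}\setminus I_i=\{v\}$; $I\leftrightarrow_{\mathrm{TS}} J$ means one exists from $I$ to $J$. A cycle $v_0,\ldots,v_k=v_0$ is $I$-bad if $|\{v_i,v_{i+1}\}\cap I|=1$ for all $i$ and $G[\{v_0,\ldots,v_{k-1}\}]$ is a cycle; its $I$-bipartition is $[A,B]=[V(C)\cap I,V(C)\setminus I]$. $C$ is resolvable with respect to $I$ if there is an independent set $I'$ with $I\leftrightarrow_{\mathrm{TS}} I'$ such that $G[I'\cup B]$ contains no cycle. -}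

module Defs where

open import Data.Nat using (ℕ; zero; suc; _≤_)
open import Data.Fin using (Fin; toℕ)
open import Data.Fin.Properties using (any?; _≟_)
open import Data.Fin.Subset using (Subset; _∈_; _∉_; _∪_; _∩_; _─_; ⁅_⁆)
open import Data.Bool using (Bool; true; false)
open import Data.Vec using (tabulate)
open import Data.Product using (Σ; ∃; _×_; _,_)
open import Data.Sum using (_⊎_)
open import Relation.Nullary using (¬_; does)
open import Relation.Binary.PropositionalEquality using (_≡_; _≢_)
open import Relation.Binary.Construct.Closure.ReflexiveTransitive using (Star)
open import Function.Definitions using (Injective)

record Graph : Set where
  field
    n     : ℕ
    adj   : Fin n → Fin n → Bool
    sym   : ∀ u v → adj u v ≡ adj v u
    irrfl : ∀ v → adj v v ≡ false

module _ (G : Graph) where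
  open Graph G

  Adj : Fin n → Fin n → Set
  Adj u v = adj u v ≡ true

  Independent : Subset n → Set
  Independent I = ∀ u v → u ∈ I → v ∈ I → ¬ Adj u v

  ClawFree : Set
  ClawFree = ¬ (Σ (Fin n) λ c → Σ (Fin n) λ a → Σ (Fin n) λ b → Σ (Fin n) λ d →
      Adj c a × Adj c b × Adj c d ×
      a ≢ b × a ≢ d × b ≢ d ×
      ¬ Adj a b × ¬ Adj a d × ¬ Adj b d)

  TSMove : Subset n → Subset n → Set
  TSMove I J = Independent I × Independent J ×
    Σ (Fin n) λ u → Σ (Fin n) λ v → Adj u v × (I ─ J ≡ ⁅ u ⁆) × (J ─ I ≡ ⁅ v ⁆)

  _↔TS_ : Subset n → Subset n → Set
  I ↔TS J = Star TSMove I J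

CycSucc : (k : ℕ) → Fin k → Fin k → Set
CycSucc k i j = (suc (toℕ i) ≡ toℕ j) ⊎ ((suc (toℕ i) ≡ k) × (toℕ j ≡ 0))

module _ (G : Graph) where
  open Graph G

  record Cycle : Set where
    field
      k      : ℕ
      3≤k    : 3 ≤ k
      vert   : Fin k → Fin n
      inj    : Injective _≡_ _≡_ vert
      edges  : ∀ i j → CycSucc k i j → Adj G (vert i) (vert j)

  open Cycle public

  Induced : Cycle → Set
  Induced C = ∀ i j → Adj G (vert C i) (vert C j) →
    CycSucc (k C) i j ⊎ CycSucc (k C) j i

  V : Cycle → Subset n
  V C = tabulate λ v → does (any? λ i → vert C i ≟ v)

  Bad : Subset n → Cycle → Set
  Bad I C = Induced C × (∀ i j → CycSucc (k C) i j →
    ((vert C i ∈ I) × (vert C j ∉ I)) ⊎ ((vert C i ∉ I) × (vert C j ∈ I)))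

  partA : Subset n → Cycle → Subset n
  partA I C = V C ∩ I

  partB : Subset n → Cycle → Subset n
  partB I C = V C ─ I

  Acyclic : Subset n → Set
  Acyclic S = ¬ (Σ Cycle λ C → ∀ i → vert C i ∈ S)

  Resolvable : Subset n → Cycle → Set
  Resolvable I C = Σ (Subset n) λ I' →
    Independent G I' × (_↔TS_ G I I') × Acyclic (I' ∪ partB I C)

_Δ_ : ∀ {n} → Subset n → Subset n → Subset n
A Δ B = (A ─ B) ∪ (B ─ A)

-- Induct on the TS-sequence I = I₀ → I₁ → … → I′ witnessing resolvability, keeping B fixed.
-- If it is empty, C itself lies in G[I′ ∪ B]. Otherwise let the first move be u → v; then
-- v ∉ V(C) as I₁ is independent, and by claw-freeness no vertex of B has a neighbour in
-- I ∖ V(C), which is why I Δ V(C) is independent. If u ∉ V(C), then C is I₁-bad with the same B: flip it from I₁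
-- and slide v back to u. If u ∈ V(C), claw-freeness at u forces v to see a cycle neighbour
-- of u. If v sees both, replacing u by v in C gives an I₁-bad cycle with the same B and the
-- same flipped set. If v sees only the predecessor of u (after reversing C if necessary),
-- the remaining tokens of C slide backwards one at a time around the even cycle, and
-- finally v slides onto that predecessor, reaching I Δ V(C) directly.
module Submission where

open import Data.Bool as Bool using (true)
open import Data.Empty using (⊥; ⊥-elim)
open import Data.Fin as Fin using (Fin; toℕ; fromℕ<; opposite)
open import Data.Fin.Properties
  using (any?; _≟_; toℕ-injective; toℕ<n; toℕ-fromℕ<; opposite-prop; opposite-involutive)
open import Data.Fin.Subset using (Subset; _∈_; _∉_; _⊆_; _∪_; _─_; ⁅_⁆; inside; outside)
open import Data.Fin.Subset.Properties
  using (_∈?_; ⊆-antisym; x∈p∪q⁻; x∈p∪q⁺; x∈⁅y⁆⇒x≡y; x∈⁅x⁆)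
open import Data.Nat
  using (ℕ; zero; suc; _+_; _∸_; _≤_; _<_; z≤n; s≤s; NonZero; >-nonZero; >-nonZero⁻¹; _≤?_; _<?_)
open import Data.Nat.DivMod
  using (_%_; %-congˡ; %-distribˡ-+; m%n%n≡m%n; [m+n]%n≡m%n; m%n<n; m<n⇒m%n≡m; n%n≡0)
open import Data.Nat.Properties hiding (_≟_; _≤?_; _<?_)
open import Data.Product using (∃; _×_; _,_; proj₁; proj₂)
open import Data.Sum using (_⊎_; inj₁; inj₂; swap)
open import Data.Vec using (_∷_; here; there; tabulate)
open import Data.Vec.Properties using (lookup∘tabulate; []=⇒lookup; lookup⇒[]=)
open import Function using (_∘_)
open import Relation.Binary.PropositionalEquality
open import Relation.Nullary using (¬_; Dec; yes; no; does; ¬?)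
open import Relation.Nullary.Decidable using (_×-dec_; _⊎-dec_)
open import Relation.Unary using (Decidable)
open import Relation.Binary.Construct.Closure.ReflexiveTransitive using (ε; _◅_; _◅◅_)

open import Defs

even⊎odd : ∀ o → (∃ λ t → o ≡ t + t) ⊎ (∃ λ t → o ≡ suc (t + t))
even⊎odd zero = inj₁ (0 , refl)
even⊎odd (suc o) with even⊎odd o
... | inj₁ (t , o≡2t) = inj₂ (t , cong suc o≡2t)
... | inj₂ (t , o≡2t+1) = inj₁ (suc t , trans (cong suc o≡2t+1) (cong suc (sym (+-suc t t))))

n≤m∧m≢n∧m≢1+n⇒2+n≤m : ∀ {m n} → n ≤ m → m ≢ n → m ≢ suc n → suc (suc n) ≤ m
n≤m∧m≢n∧m≢1+n⇒2+n≤m n≤m m≢n m≢1+n =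
  ≤∧≢⇒< (≤∧≢⇒< n≤m (m≢n ∘ sym)) (m≢1+n ∘ sym)

m<2+n∧m≢1+n∧m≢n⇒m<n : ∀ {m n} → m < suc (suc n) → m ≢ suc n → m ≢ n → m < n
m<2+n∧m≢1+n∧m≢n⇒m<n m<2+n m≢1+n m≢n =
  ≤∧≢⇒< (≤-pred (≤∧≢⇒< (≤-pred m<2+n) m≢1+n)) m≢n

CycSuccℕ : ℕ → ℕ → ℕ → Set
CycSuccℕ k a b = (suc a ≡ b) ⊎ (suc a ≡ k × b ≡ 0)

module _ {k : ℕ} .{{_ : NonZero k}} where
  open ≡-Reasoning

  [m%k+n]%k≡[m+n]%k : ∀ m n → (m % k + n) % k ≡ (m + n) % k
  [m%k+n]%k≡[m+n]%k m n = begin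
    (m % k + n) % k          ≡⟨ %-distribˡ-+ (m % k) n k ⟩
    (m % k % k + n % k) % k  ≡⟨ %-congˡ (cong (_+ n % k) (m%n%n≡m%n m k)) ⟩
    (m % k + n % k) % k      ≡⟨ %-distribˡ-+ m n k ⟨
    (m + n) % k              ∎

  [m+n%k]%k≡[m+n]%k : ∀ m n → (m + n % k) % k ≡ (m + n) % k
  [m+n%k]%k≡[m+n]%k m n = begin
    (m + n % k) % k  ≡⟨ %-congˡ (+-comm m (n % k)) ⟩
    (n % k + m) % k  ≡⟨ [m%k+n]%k≡[m+n]%k n m ⟩
    (n + m) % k      ≡⟨ %-congˡ (+-comm n m) ⟩
    (m + n) % k      ∎

  %-cycSucc : ∀ m → CycSuccℕ k (m % k) (suc m % k)
  %-cycSucc m with suc (m % k) <? k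
  ... | yes 1+r<k = inj₁ (begin
    suc (m % k)      ≡⟨ m<n⇒m%n≡m 1+r<k ⟨
    suc (m % k) % k  ≡⟨ [m+n%k]%k≡[m+n]%k 1 m ⟩
    suc m % k        ∎)
  ... | no 1+r≮k = inj₂ (1+r≡k , (begin
    suc m % k        ≡⟨ [m+n%k]%k≡[m+n]%k 1 m ⟨
    suc (m % k) % k  ≡⟨ %-congˡ 1+r≡k ⟩
    k % k            ≡⟨ n%n≡0 k ⟩
    0                ∎))
    where
    1+r≡k : suc (m % k) ≡ k
    1+r≡k = ≤-antisym (m%n<n m k) (≮⇒≥ 1+r≮k)

  module Offsets (p : Fin k) where

    offset : Fin k → ℕ
    offset j = (toℕ j + (k ∸ toℕ p)) % k

    forward : ℕ → Fin k
    forward o = fromℕ< (m%n<n (toℕ p + o) k)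

    toℕ-forward : ∀ o → toℕ (forward o) ≡ (toℕ p + o) % k
    toℕ-forward o = toℕ-fromℕ< _

    offset<k : ∀ j → offset j < k
    offset<k j = m%n<n _ k

    private
      p+[k∸p]≡k : toℕ p + (k ∸ toℕ p) ≡ k
      p+[k∸p]≡k = m+[n∸m]≡n (<⇒≤ (toℕ<n p))

      [o+p]%k≡o : ∀ {o} → o < k → (o + toℕ p + (k ∸ toℕ p)) % k ≡ o
      [o+p]%k≡o {o} o<k = begin
        (o + toℕ p + (k ∸ toℕ p)) % k  ≡⟨ %-congˡ (trans (+-assoc o _ _) (cong (o +_) p+[k∸p]≡k)) ⟩
        (o + k) % k                    ≡⟨ [m+n]%n≡m%n o k ⟩
        o % k                          ≡⟨ m<n⇒m%n≡m o<k ⟩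
        o                              ∎

    offset-forward : ∀ {o} → o < k → offset (forward o) ≡ o
    offset-forward {o} o<k = begin
      (toℕ (forward o) + (k ∸ toℕ p)) % k  ≡⟨ %-congˡ (cong (_+ (k ∸ toℕ p)) (toℕ-forward o)) ⟩
      ((toℕ p + o) % k + (k ∸ toℕ p)) % k  ≡⟨ [m%k+n]%k≡[m+n]%k (toℕ p + o) _ ⟩
      (toℕ p + o + (k ∸ toℕ p)) % k        ≡⟨ %-congˡ (cong (_+ (k ∸ toℕ p)) (+-comm (toℕ p) o)) ⟩
      (o + toℕ p + (k ∸ toℕ p)) % k        ≡⟨ [o+p]%k≡o o<k ⟩
      o                                    ∎

    forward-offset : ∀ j → forward (offset j) ≡ j
    forward-offset j = toℕ-injective (begin
      toℕ (forward (offset j))                       ≡⟨ toℕ-forward (offset j) ⟩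
      (toℕ p + (toℕ j + (k ∸ toℕ p)) % k) % k        ≡⟨ [m+n%k]%k≡[m+n]%k (toℕ p) _ ⟩
      (toℕ p + (toℕ j + (k ∸ toℕ p))) % k            ≡⟨ %-congˡ (+-assoc (toℕ p) (toℕ j) _) ⟨
      (toℕ p + toℕ j + (k ∸ toℕ p)) % k
        ≡⟨ %-congˡ (cong (_+ (k ∸ toℕ p)) (+-comm (toℕ p) (toℕ j))) ⟩
      (toℕ j + toℕ p + (k ∸ toℕ p)) % k              ≡⟨ [o+p]%k≡o (toℕ<n j) ⟩
      toℕ j                                          ∎)

    forward-cycSucc : ∀ o → CycSucc k (forward o) (forward (suc o))
    forward-cycSucc o = subst₂ (CycSuccℕ k) (sym (toℕ-forward o))
      (sym (trans (toℕ-forward (suc o)) (%-congˡ (+-suc (toℕ p) o))))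
      (%-cycSucc (toℕ p + o))

    forward-0 : forward 0 ≡ p
    forward-0 = toℕ-injective (trans (toℕ-forward 0)
      (trans (%-congˡ (+-identityʳ (toℕ p))) (m<n⇒m%n≡m (toℕ<n p))))

    forward-k : forward k ≡ p
    forward-k = toℕ-injective (trans (toℕ-forward k)
      (trans ([m+n]%n≡m%n (toℕ p) k) (m<n⇒m%n≡m (toℕ<n p))))

    offset-cycSucc : ∀ {i j} → CycSucc k i j → CycSuccℕ k (offset i) (offset j)
    offset-cycSucc {i} {j} i→j = subst (CycSuccℕ k (offset i)) (sym (offset≡ i→j))
      (%-cycSucc (toℕ i + (k ∸ toℕ p)))
      where
      offset≡ : CycSucc k i j → offset j ≡ suc (toℕ i + (k ∸ toℕ p)) % k
      offset≡ (inj₁ 1+i≡j) = %-congˡ (cong (_+ (k ∸ toℕ p)) (sym 1+i≡j))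
      offset≡ (inj₂ (1+i≡k , j≡0)) = begin
        (toℕ j + (k ∸ toℕ p)) % k        ≡⟨ %-congˡ (cong (_+ (k ∸ toℕ p)) j≡0) ⟩
        (k ∸ toℕ p) % k                  ≡⟨ [m+n]%n≡m%n (k ∸ toℕ p) k ⟨
        ((k ∸ toℕ p) + k) % k            ≡⟨ %-congˡ (+-comm (k ∸ toℕ p) k) ⟩
        (k + (k ∸ toℕ p)) % k            ≡⟨ %-congˡ (cong (_+ (k ∸ toℕ p)) (sym 1+i≡k)) ⟩
        (suc (toℕ i) + (k ∸ toℕ p)) % k  ∎

    offset-origin : offset p ≡ 0
    offset-origin = trans (cong offset (sym forward-0)) (offset-forward (>-nonZero⁻¹ k))

Consecutive : (k : ℕ) → Fin k → Fin k → Set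
Consecutive k i j = CycSucc k i j ⊎ CycSucc k j i

module _ {k : ℕ} where

  cycSucc-functional : ∀ {i j j′} → CycSucc k i j → CycSucc k i j′ → j ≡ j′
  cycSucc-functional (inj₁ a) (inj₁ b) = toℕ-injective (trans (sym a) b)
  cycSucc-functional {j = j} (inj₁ a) (inj₂ (b , _)) = ⊥-elim (<⇒≢ (toℕ<n j) (trans (sym a) b))
  cycSucc-functional {j′ = j′} (inj₂ (b , _)) (inj₁ a) = ⊥-elim (<⇒≢ (toℕ<n j′) (trans (sym a) b))
  cycSucc-functional (inj₂ (_ , c)) (inj₂ (_ , d)) = toℕ-injective (trans c (sym d))

  cycSucc-injective : ∀ {i i′ j} → CycSucc k i j → CycSucc k i′ j → i ≡ i′
  cycSucc-injective (inj₁ a) (inj₁ b) = toℕ-injective (suc-injective (trans a (sym b)))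
  cycSucc-injective (inj₁ a) (inj₂ (_ , c)) with trans a c
  ... | ()
  cycSucc-injective (inj₂ (_ , c)) (inj₁ a) with trans a c
  ... | ()
  cycSucc-injective (inj₂ (a , _)) (inj₂ (b , _)) = toℕ-injective (suc-injective (trans a (sym b)))

  cycSucc-opposite : ∀ {i j} → CycSucc k i j → CycSucc k (opposite j) (opposite i)
  cycSucc-opposite {i} {j} (inj₁ 1+i≡j) = inj₁ (begin
    suc (toℕ (opposite j))  ≡⟨ cong suc (opposite-prop j) ⟩
    suc (k ∸ suc (toℕ j))   ≡⟨ +-∸-assoc 1 (toℕ<n j) ⟨
    k ∸ toℕ j               ≡⟨ cong (k ∸_) 1+i≡j ⟨
    k ∸ suc (toℕ i)         ≡⟨ opposite-prop i ⟨
    toℕ (opposite i)        ∎)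
    where open ≡-Reasoning
  cycSucc-opposite {i} {j} (inj₂ (1+i≡k , j≡0)) =
    inj₂ ( trans (cong suc (trans (opposite-prop j) (cong (λ z → k ∸ suc z) j≡0)))
                 (m+[n∸m]≡n (≤-trans (s≤s z≤n) (toℕ<n i)))
         , trans (opposite-prop i) (trans (cong (k ∸_) 1+i≡k) (n∸n≡0 k)) )

  cycSucc-opposite⁻ : ∀ {i j} → CycSucc k (opposite i) (opposite j) → CycSucc k j i
  cycSucc-opposite⁻ {i} {j} =
    subst₂ (CycSucc k) (opposite-involutive j) (opposite-involutive i) ∘ cycSucc-opposite

module CyclicOrder {k : ℕ} (3≤k : 3 ≤ k) where

  instance
    k-nonZero : NonZero k
    k-nonZero = >-nonZero (≤-trans (s≤s z≤n) 3≤k)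

  next prev : Fin k → Fin k
  next i = Offsets.forward i 1
  prev i = Offsets.forward i (k ∸ 1)

  cycSucc-next : ∀ i → CycSucc k i (next i)
  cycSucc-next i = subst (λ i′ → CycSucc k i′ (next i)) forward-0 (forward-cycSucc 0)
    where open Offsets i

  cycSucc-prev : ∀ i → CycSucc k (prev i) i
  cycSucc-prev i = subst (CycSucc k (prev i)) (trans (cong forward 1+[k∸1]≡k) forward-k)
    (forward-cycSucc (k ∸ 1))
    where
    open Offsets i
    1+[k∸1]≡k : suc (k ∸ 1) ≡ k
    1+[k∸1]≡k = m+[n∸m]≡n (≤-trans (s≤s z≤n) 3≤k)

  private
    1≢k : 1 ≢ k
    1≢k = <⇒≢ (≤-trans (n≤1+n 2) 3≤k)

    2≢k : 2 ≢ k
    2≢k = <⇒≢ 3≤k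

  cycSucc-irrefl : ∀ {i} → ¬ CycSucc k i i
  cycSucc-irrefl (inj₁ a) = 1+n≢n a
  cycSucc-irrefl (inj₂ (a , b)) = 1≢k (trans (cong suc (sym b)) a)

  cycSucc-asym : ∀ {i j} → CycSucc k i j → ¬ CycSucc k j i
  cycSucc-asym (inj₁ a) (inj₁ b) = m≢1+n+m _ (sym (trans (cong suc a) b))
  cycSucc-asym (inj₁ a) (inj₂ (b , c)) = 2≢k (trans (cong (suc ∘ suc) (sym c)) (trans (cong suc a) b))
  cycSucc-asym (inj₂ (b , c)) (inj₁ a) = 2≢k (trans (cong (suc ∘ suc) (sym c)) (trans (cong suc a) b))
  cycSucc-asym (inj₂ (a , b)) (inj₂ (c , d)) = 1≢k (trans (cong suc (sym b)) c)

  next≢prev : ∀ i → next i ≢ prev i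
  next≢prev i e = cycSucc-asym (cycSucc-next i) (subst (λ j → CycSucc k j i) (sym e) (cycSucc-prev i))

x∈p─q⁻ : ∀ {n} (p q : Subset n) {x} → x ∈ p ─ q → x ∈ p × x ∉ q
x∈p─q⁻ (inside ∷ p) (outside ∷ q) here = here , λ ()
x∈p─q⁻ (inside ∷ p) (inside ∷ q) {Fin.zero} ()
x∈p─q⁻ (outside ∷ p) (inside ∷ q) {Fin.zero} ()
x∈p─q⁻ (outside ∷ p) (outside ∷ q) {Fin.zero} ()
x∈p─q⁻ (_ ∷ p) (_ ∷ q) (there x∈) with x∈p─q⁻ p q x∈
... | x∈p , x∉q = there x∈p , λ { (there x∈q) → x∉q x∈q }

x∈p─q⁺ : ∀ {n} (p q : Subset n) {x} → x ∈ p → x ∉ q → x ∈ p ─ q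
x∈p─q⁺ (inside ∷ p) (inside ∷ q) here x∉q = ⊥-elim (x∉q here)
x∈p─q⁺ (inside ∷ p) (outside ∷ q) here x∉q = here
x∈p─q⁺ (_ ∷ p) (_ ∷ q) (there x∈p) x∉q = there (x∈p─q⁺ p q x∈p (x∉q ∘ there))

p─q≡⁅x⁆ : ∀ {n} {p q : Subset n} {x y} → x ∈ p → x ∉ q → y ∉ p →
  (∀ {z} → z ≢ x → z ≢ y → z ∈ p → z ∈ q) → p ─ q ≡ ⁅ x ⁆
p─q≡⁅x⁆ {p = p} {q} {x} {y} x∈p x∉q y∉p keep = ⊆-antisym ⊆⁅x⁆ ⁅x⁆⊆
  where
  ⊆⁅x⁆ : p ─ q ⊆ ⁅ x ⁆
  ⊆⁅x⁆ {z} z∈ with x∈p─q⁻ p q z∈ | z ≟ x | z ≟ y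
  ... | _ | yes refl | _ = x∈⁅x⁆ x
  ... | z∈p , _ | no _ | yes refl = ⊥-elim (y∉p z∈p)
  ... | z∈p , z∉q | no z≢x | no z≢y = ⊥-elim (z∉q (keep z≢x z≢y z∈p))
  ⁅x⁆⊆ : ⁅ x ⁆ ⊆ p ─ q
  ⁅x⁆⊆ z∈ rewrite x∈⁅y⁆⇒x≡y x z∈ = x∈p─q⁺ p q x∈p x∉q

module _ {n : ℕ} where

  x∈pΔq⁻ : ∀ (p q : Subset n) {x} → x ∈ p Δ q → (x ∈ p × x ∉ q) ⊎ (x ∈ q × x ∉ p)
  x∈pΔq⁻ p q x∈ with x∈p∪q⁻ (p ─ q) (q ─ p) x∈
  ... | inj₁ x∈p─q = inj₁ (x∈p─q⁻ p q x∈p─q)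
  ... | inj₂ x∈q─p = inj₂ (x∈p─q⁻ q p x∈q─p)

  x∈pΔq⁺ˡ : ∀ (p q : Subset n) {x} → x ∈ p → x ∉ q → x ∈ p Δ q
  x∈pΔq⁺ˡ p q x∈p x∉q = x∈p∪q⁺ (inj₁ (x∈p─q⁺ p q x∈p x∉q))

  x∈pΔq⁺ʳ : ∀ (p q : Subset n) {x} → x ∈ q → x ∉ p → x ∈ p Δ q
  x∈pΔq⁺ʳ p q x∈q x∉p = x∈p∪q⁺ (inj₂ (x∈p─q⁺ q p x∈q x∉p))

  subsetOf : {P : Fin n → Set} → Decidable P → Subset n
  subsetOf P? = tabulate (λ x → does (P? x))

  ∈-subsetOf⁻ : {P : Fin n → Set} (P? : Decidable P) {x : Fin n} → x ∈ subsetOf P? → P x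
  ∈-subsetOf⁻ P? {x} x∈ with P? x | trans (sym (lookup∘tabulate (λ y → does (P? y)) x)) ([]=⇒lookup x∈)
  ... | yes Px | _ = Px

  ∈-subsetOf⁺ : {P : Fin n → Set} (P? : Decidable P) {x : Fin n} → P x → x ∈ subsetOf P?
  ∈-subsetOf⁺ {P} P? {x} Px =
    lookup⇒[]= x _ (trans (lookup∘tabulate (λ y → does (P? y)) x) (does≡true (P? x)))
    where
    does≡true : (d : Dec (P x)) → does d ≡ true
    does≡true (yes _) = refl
    does≡true (no ¬Px) = ⊥-elim (¬Px Px)

module _ (G : Graph) where
  open Graph G using (n; adj)

  Adj-sym : ∀ {u v} → Adj G u v → Adj G v u
  Adj-sym {u} {v} = trans (Graph.sym G v u)

  Adj-irrefl : ∀ {u} → ¬ Adj G u u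
  Adj-irrefl {u} u~u with trans (sym (Graph.irrfl G u)) u~u
  ... | ()

  Adj? : ∀ u v → Dec (Adj G u v)
  Adj? u v = adj u v Bool.≟ true

  no-independent-claw : ClawFree G → ∀ {S c a b d} → Independent G S →
    a ∈ S → b ∈ S → d ∈ S → a ≢ b → a ≢ d → b ≢ d →
    Adj G c a → Adj G c b → Adj G c d → ⊥
  no-independent-claw cf {S} {c} {a} {b} {d} S-ind a∈S b∈S d∈S a≢b a≢d b≢d c~a c~b c~d =
    cf (c , a , b , d , c~a , c~b , c~d , a≢b , a≢d , b≢d ,
        S-ind a b a∈S b∈S , S-ind a d a∈S d∈S , S-ind b d b∈S d∈S)

  tsMove : ∀ {I J u v} → Independent G I → Independent G J → Adj G u v →
    u ∈ I → u ∉ J → v ∉ I → v ∈ J →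
    (∀ {x} → x ≢ u → x ≢ v → x ∈ I → x ∈ J) →
    (∀ {x} → x ≢ u → x ≢ v → x ∈ J → x ∈ I) → TSMove G I J
  tsMove I-ind J-ind u~v u∈I u∉J v∉I v∈J I⊆J J⊆I =
    I-ind , J-ind , _ , _ , u~v ,
    p─q≡⁅x⁆ u∈I u∉J v∉I I⊆J , p─q≡⁅x⁆ v∈J v∉I u∉J (λ x≢v x≢u → J⊆I x≢u x≢v)

  module Move {I J : Subset n} (m : TSMove G I J) where

    I-independent : Independent G I
    I-independent = proj₁ m

    J-independent : Independent G J
    J-independent = proj₁ (proj₂ m)

    from to : Fin n
    from = proj₁ (proj₂ (proj₂ m))
    to = proj₁ (proj₂ (proj₂ (proj₂ m)))

    from~to : Adj G from to
    from~to = proj₁ (proj₂ (proj₂ (proj₂ (proj₂ m))))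

    private
      I─J≡⁅from⁆ : I ─ J ≡ ⁅ from ⁆
      I─J≡⁅from⁆ = proj₁ (proj₂ (proj₂ (proj₂ (proj₂ (proj₂ m)))))

      J─I≡⁅to⁆ : J ─ I ≡ ⁅ to ⁆
      J─I≡⁅to⁆ = proj₂ (proj₂ (proj₂ (proj₂ (proj₂ (proj₂ m)))))

    from∈I : from ∈ I
    from∈I = proj₁ (x∈p─q⁻ I J (subst (from ∈_) (sym I─J≡⁅from⁆) (x∈⁅x⁆ from)))

    from∉J : from ∉ J
    from∉J = proj₂ (x∈p─q⁻ I J (subst (from ∈_) (sym I─J≡⁅from⁆) (x∈⁅x⁆ from)))

    to∈J : to ∈ J
    to∈J = proj₁ (x∈p─q⁻ J I (subst (to ∈_) (sym J─I≡⁅to⁆) (x∈⁅x⁆ to)))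

    to∉I : to ∉ I
    to∉I = proj₂ (x∈p─q⁻ J I (subst (to ∈_) (sym J─I≡⁅to⁆) (x∈⁅x⁆ to)))

    ∈I⇒∈J : ∀ {x} → x ≢ from → x ∈ I → x ∈ J
    ∈I⇒∈J {x} x≢from x∈I with x ∈? J
    ... | yes x∈J = x∈J
    ... | no x∉J =
      ⊥-elim (x≢from (x∈⁅y⁆⇒x≡y from (subst (x ∈_) I─J≡⁅from⁆ (x∈p─q⁺ I J x∈I x∉J))))

    ∈J⇒∈I : ∀ {x} → x ≢ to → x ∈ J → x ∈ I
    ∈J⇒∈I {x} x≢to x∈J with x ∈? I
    ... | yes x∈I = x∈I
    ... | no x∉I =
      ⊥-elim (x≢to (x∈⁅y⁆⇒x≡y to (subst (x ∈_) J─I≡⁅to⁆ (x∈p─q⁺ J I x∈J x∉I))))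

    ∈J⇒≢from : ∀ {x} → x ∈ J → x ≢ from
    ∈J⇒≢from x∈J refl = from∉J x∈J

  module OnCycle (C : Cycle G) where
    open CyclicOrder (3≤k C) public

    vert-≢ : ∀ {i j} → i ≢ j → vert C i ≢ vert C j
    vert-≢ i≢j vi≡vj = i≢j (inj C vi≡vj)

    ∈V⁻ : ∀ {x} → x ∈ V G C → ∃ λ i → vert C i ≡ x
    ∈V⁻ = ∈-subsetOf⁻ (λ x → any? (λ i → vert C i ≟ x))

    vert∈V : ∀ i → vert C i ∈ V G C
    vert∈V i = ∈-subsetOf⁺ (λ x → any? (λ j → vert C j ≟ x)) (i , refl)

    edge-next : ∀ i → Adj G (vert C i) (vert C (next i))
    edge-next i = edges C i (next i) (cycSucc-next i)

    edge-prev : ∀ i → Adj G (vert C i) (vert C (prev i))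
    edge-prev i = Adj-sym (edges C (prev i) i (cycSucc-prev i))

  module BadCycle (cf : ClawFree G) {I : Subset n} (I-ind : Independent G I)
                  (C : Cycle G) (bad : Bad G I C) where
    open OnCycle C

    ∈I⇒neighbour∉I : ∀ {i j} → Consecutive (k C) i j → vert C i ∈ I → vert C j ∉ I
    ∈I⇒neighbour∉I {i} {j} (inj₁ i→j) i∈I with proj₂ bad i j i→j
    ... | inj₁ (_ , j∉I) = j∉I
    ... | inj₂ (i∉I , _) = ⊥-elim (i∉I i∈I)
    ∈I⇒neighbour∉I {i} {j} (inj₂ j→i) i∈I j∈I with proj₂ bad j i j→i
    ... | inj₁ (_ , i∉I) = i∉I i∈I
    ... | inj₂ (j∉I , _) = j∉I j∈I

    ∉I⇒neighbour∈I : ∀ {i j} → Consecutive (k C) i j → vert C i ∉ I → vert C j ∈ I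
    ∉I⇒neighbour∈I {i} {j} (inj₁ i→j) i∉I with proj₂ bad i j i→j
    ... | inj₁ (i∈I , _) = ⊥-elim (i∉I i∈I)
    ... | inj₂ (_ , j∈I) = j∈I
    ∉I⇒neighbour∈I {i} {j} (inj₂ j→i) i∉I with proj₂ bad j i j→i
    ... | inj₁ (j∈I , _) = j∈I
    ... | inj₂ (_ , i∈I) = ⊥-elim (i∉I i∈I)

    next∈I : ∀ {i} → vert C i ∉ I → vert C (next i) ∈ I
    next∈I = ∉I⇒neighbour∈I (inj₁ (cycSucc-next _))

    prev∈I : ∀ {i} → vert C i ∉ I → vert C (prev i) ∈ I
    prev∈I = ∉I⇒neighbour∈I (inj₂ (cycSucc-prev _))

    B-independent : ∀ {i j} → vert C i ∉ I → vert C j ∉ I → ¬ Adj G (vert C i) (vert C j)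
    B-independent {i} {j} i∉I j∉I i~j = j∉I (∉I⇒neighbour∈I (proj₁ bad i j i~j) i∉I)

    -- The two cycle neighbours of a vertex of B and a third I-neighbour would form a claw.
    B≁I─V : ∀ {j x} → vert C j ∉ I → x ∈ I → x ∉ V G C → ¬ Adj G (vert C j) x
    B≁I─V {j} {x} j∉I x∈I x∉V j~x =
      no-independent-claw cf I-ind (next∈I j∉I) (prev∈I j∉I) x∈I (vert-≢ (next≢prev j))
        (λ e → x∉V (subst (_∈ V G C) e (vert∈V (next j))))
        (λ e → x∉V (subst (_∈ V G C) e (vert∈V (prev j))))
        (edge-next j) (edge-prev j) j~x

    Δ-independent : Independent G (I Δ V G C)
    Δ-independent x y x∈ y∈ x~y with x∈pΔq⁻ I (V G C) x∈ | x∈pΔq⁻ I (V G C) y∈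
    ... | inj₁ (x∈I , _) | inj₁ (y∈I , _) = I-ind x y x∈I y∈I x~y
    ... | inj₁ (x∈I , x∉V) | inj₂ (y∈V , y∉I) with ∈V⁻ y∈V
    ...   | j , refl = B≁I─V y∉I x∈I x∉V (Adj-sym x~y)
    Δ-independent x y x∈ y∈ x~y | inj₂ (x∈V , x∉I) | inj₁ (y∈I , y∉V) with ∈V⁻ x∈V
    ...   | i , refl = B≁I─V x∉I y∈I y∉V x~y
    Δ-independent x y x∈ y∈ x~y | inj₂ (x∈V , x∉I) | inj₂ (y∈V , y∉I) with ∈V⁻ x∈V | ∈V⁻ y∈V
    ...   | i , refl | j , refl = B-independent x∉I y∉I x~y

  module MoveAtBadCycle (cf : ClawFree G) {I J : Subset n} (m : TSMove G I J)
                        (C : Cycle G) (bad : Bad G I C) where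
    open Move m
    open OnCycle C
    open BadCycle cf I-independent C bad

    ∉I⇒∉J : ∀ {j} → vert C j ∉ I → vert C j ∉ J
    ∉I⇒∉J {j} j∉I j∈J with vert C (next j) ≟ from
    ... | no next≢from = J-independent _ _ j∈J (∈I⇒∈J next≢from (next∈I j∉I)) (edge-next j)
    ... | yes next≡from = J-independent _ _ j∈J (∈I⇒∈J prev≢from (prev∈I j∉I)) (edge-prev j)
      where
      prev≢from = λ prev≡from → vert-≢ (next≢prev j) (trans next≡from (sym prev≡from))

    vert≢to : ∀ j → vert C j ≢ to
    vert≢to j j≡to = ∉I⇒∉J (subst (_∉ I) (sym j≡to) to∉I) (subst (_∈ J) (sym j≡to) to∈J)

    to∉V : to ∉ V G C
    to∉V to∈V with ∈V⁻ to∈V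
    ... | j , j≡to = vert≢to j j≡to

    module _ {p : Fin (k C)} (p≡from : vert C p ≡ from) where

      ≢p⇒≢from : ∀ {i} → i ≢ p → vert C i ≢ from
      ≢p⇒≢from i≢p i≡from = i≢p (inj C (trans i≡from (sym p≡from)))

      -- A B-neighbour j of to that is not beside from would be the centre of a claw
      -- with its two cycle neighbours and to, all in J.
      to~B⇒beside-from : ∀ {j} → vert C j ∉ I → Adj G to (vert C j) → Consecutive (k C) p j
      to~B⇒beside-from {j} j∉I to~j with next j ≟ p | prev j ≟ p
      ... | yes next≡p | _ = inj₂ (subst (CycSucc (k C) j) next≡p (cycSucc-next j))
      ... | no _ | yes prev≡p = inj₁ (subst (λ i → CycSucc (k C) i j) prev≡p (cycSucc-prev j))
      ... | no next≢p | no prev≢p = ⊥-elim (no-independent-claw cf J-independent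
            (∈I⇒∈J (≢p⇒≢from next≢p) (next∈I j∉I))
            (∈I⇒∈J (≢p⇒≢from prev≢p) (prev∈I j∉I)) to∈J
            (vert-≢ (next≢prev j)) (vert≢to _) (vert≢to _)
            (edge-next j) (edge-prev j) (Adj-sym to~j))

      p∈I : vert C p ∈ I
      p∈I = subst (_∈ I) (sym p≡from) from∈I

      next∉I : vert C (next p) ∉ I
      next∉I = ∈I⇒neighbour∉I (inj₁ (cycSucc-next p)) p∈I

      prev∉I : vert C (prev p) ∉ I
      prev∉I = ∈I⇒neighbour∉I (inj₂ (cycSucc-prev p)) p∈I

      to-beside-from : ¬ (¬ Adj G to (vert C (next p)) × ¬ Adj G to (vert C (prev p)))
      to-beside-from (to≁next , to≁prev) = cf (from , vert C (next p) , vert C (prev p) , to ,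
        subst (λ x → Adj G x _) p≡from (edge-next p) ,
        subst (λ x → Adj G x _) p≡from (edge-prev p) , from~to ,
        vert-≢ (next≢prev p) , vert≢to _ , vert≢to _ ,
        B-independent next∉I prev∉I , to≁next ∘ Adj-sym , to≁prev ∘ Adj-sym)

  module MoveOffCycle (cf : ClawFree G) {I J : Subset n} (m : TSMove G I J)
                      (C : Cycle G) (bad : Bad G I C) (from∉V : Move.from m ∉ V G C) where
    open Move m
    open OnCycle C
    open MoveAtBadCycle cf m C bad using (to∉V)

    private
      ∈V∩I⇒∈J : ∀ {x} → x ∈ V G C → x ∈ I → x ∈ J
      ∈V∩I⇒∈J x∈V = ∈I⇒∈J λ { refl → from∉V x∈V }

      ∈V∩J⇒∈I : ∀ {x} → x ∈ V G C → x ∈ J → x ∈ I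
      ∈V∩J⇒∈I x∈V = ∈J⇒∈I λ { refl → to∉V x∈V }

    bad-J : Bad G J C
    bad-J = proj₁ bad , alternates
      where
      alternates : ∀ i j → CycSucc (k C) i j →
        (vert C i ∈ J × vert C j ∉ J) ⊎ (vert C i ∉ J × vert C j ∈ J)
      alternates i j i→j with proj₂ bad i j i→j
      ... | inj₁ (i∈I , j∉I) = inj₁ (∈V∩I⇒∈J (vert∈V i) i∈I , j∉I ∘ ∈V∩J⇒∈I (vert∈V j))
      ... | inj₂ (i∉I , j∈I) = inj₂ (i∉I ∘ ∈V∩J⇒∈I (vert∈V i) , ∈V∩I⇒∈J (vert∈V j) j∈I)

    partB-J : partB G J C ≡ partB G I C
    partB-J = ⊆-antisym (B-mono ∈V∩I⇒∈J) (B-mono ∈V∩J⇒∈I)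
      where
      B-mono : ∀ {K L} → (∀ {x} → x ∈ V G C → x ∈ K → x ∈ L) → V G C ─ L ⊆ V G C ─ K
      B-mono {K} {L} K⇒L x∈ with x∈p─q⁻ (V G C) L x∈
      ... | x∈V , x∉L = x∈p─q⁺ (V G C) K x∈V (x∉L ∘ K⇒L x∈V)

    move-back : TSMove G (J Δ V G C) (I Δ V G C)
    move-back = tsMove (BadCycle.Δ-independent cf J-independent C bad-J)
      (BadCycle.Δ-independent cf I-independent C bad) (Adj-sym from~to)
      (x∈pΔq⁺ˡ J (V G C) to∈J to∉V) to∉ from∉ (x∈pΔq⁺ˡ I (V G C) from∈I from∉V)
      J⇒I I⇒J
      where
      to∉ : to ∉ I Δ V G C
      to∉ x∈ with x∈pΔq⁻ I (V G C) x∈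
      ... | inj₁ (to∈I , _) = to∉I to∈I
      ... | inj₂ (to∈V , _) = to∉V to∈V
      from∉ : from ∉ J Δ V G C
      from∉ x∈ with x∈pΔq⁻ J (V G C) x∈
      ... | inj₁ (from∈J , _) = from∉J from∈J
      ... | inj₂ (from∈V , _) = from∉V from∈V
      J⇒I : ∀ {x} → x ≢ to → x ≢ from → x ∈ J Δ V G C → x ∈ I Δ V G C
      J⇒I x≢to x≢from x∈ with x∈pΔq⁻ J (V G C) x∈
      ... | inj₁ (x∈J , x∉V) = x∈pΔq⁺ˡ I (V G C) (∈J⇒∈I x≢to x∈J) x∉V
      ... | inj₂ (x∈V , x∉J) = x∈pΔq⁺ʳ I (V G C) x∈V (x∉J ∘ ∈I⇒∈J x≢from)
      I⇒J : ∀ {x} → x ≢ to → x ≢ from → x ∈ I Δ V G C → x ∈ J Δ V G C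
      I⇒J x≢to x≢from x∈ with x∈pΔq⁻ I (V G C) x∈
      ... | inj₁ (x∈I , x∉V) = x∈pΔq⁺ˡ J (V G C) (∈I⇒∈J x≢from x∈I) x∉V
      ... | inj₂ (x∈V , x∉I) = x∈pΔq⁺ʳ J (V G C) x∈V (x∉I ∘ ∈J⇒∈I x≢to)

  module Substitution (cf : ClawFree G) {I J : Subset n} (m : TSMove G I J)
                      (C : Cycle G) (bad : Bad G I C) {p : Fin (k C)}
                      (p≡from : vert C p ≡ Move.from m)
                      (to~next : Adj G (Move.to m) (vert C (CyclicOrder.next (3≤k C) p)))
                      (to~prev : Adj G (Move.to m) (vert C (CyclicOrder.prev (3≤k C) p))) where
    open Move m
    open OnCycle C
    open MoveAtBadCycle cf m C bad

    vert′ : Fin (k C) → Fin n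
    vert′ i with i ≟ p
    ... | yes _ = to
    ... | no _ = vert C i

    vert′-cases : ∀ i → (i ≡ p × vert′ i ≡ to) ⊎ (i ≢ p × vert′ i ≡ vert C i)
    vert′-cases i with i ≟ p
    ... | yes i≡p = inj₁ (i≡p , refl)
    ... | no i≢p = inj₂ (i≢p , refl)

    vert′-p : vert′ p ≡ to
    vert′-p with vert′-cases p
    ... | inj₁ (_ , p≡to) = p≡to
    ... | inj₂ (p≢p , _) = ⊥-elim (p≢p refl)

    vert′-injective : ∀ {i j} → vert′ i ≡ vert′ j → i ≡ j
    vert′-injective {i} {j} e with vert′-cases i | vert′-cases j
    ... | inj₁ (i≡p , _) | inj₁ (j≡p , _) = trans i≡p (sym j≡p)
    ... | inj₁ (_ , i≡to) | inj₂ (_ , j≡vj) =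
          ⊥-elim (vert≢to j (trans (sym j≡vj) (trans (sym e) i≡to)))
    ... | inj₂ (_ , i≡vi) | inj₁ (_ , j≡to) = ⊥-elim (vert≢to i (trans (sym i≡vi) (trans e j≡to)))
    ... | inj₂ (_ , i≡vi) | inj₂ (_ , j≡vj) = inj C (trans (sym i≡vi) (trans e j≡vj))

    edges′ : ∀ i j → CycSucc (k C) i j → Adj G (vert′ i) (vert′ j)
    edges′ i j i→j with vert′-cases i | vert′-cases j
    ... | inj₁ (refl , _) | inj₁ (refl , _) = ⊥-elim (cycSucc-irrefl i→j)
    ... | inj₁ (refl , i≡to) | inj₂ (_ , j≡vj) = subst₂ (Adj G) (sym i≡to) (sym j≡vj)
          (subst (λ j → Adj G to (vert C j)) (cycSucc-functional (cycSucc-next p) i→j) to~next)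
    ... | inj₂ (_ , i≡vi) | inj₁ (refl , j≡to) = subst₂ (Adj G) (sym i≡vi) (sym j≡to)
          (Adj-sym (subst (λ i → Adj G to (vert C i)) (cycSucc-injective (cycSucc-prev p) i→j) to~prev))
    ... | inj₂ (_ , i≡vi) | inj₂ (_ , j≡vj) = subst₂ (Adj G) (sym i≡vi) (sym j≡vj) (edges C i j i→j)

    C′ : Cycle G
    C′ = record { k = k C ; 3≤k = 3≤k C ; vert = vert′ ; inj = vert′-injective ; edges = edges′ }

    vert′∈J⇒vert∈I : ∀ i → vert′ i ∈ J → vert C i ∈ I
    vert′∈J⇒vert∈I i i∈J with vert′-cases i
    ... | inj₁ (refl , _) = subst (_∈ I) (sym p≡from) from∈I
    ... | inj₂ (_ , i≡vi) = ∈J⇒∈I (vert≢to i) (subst (_∈ J) i≡vi i∈J)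

    vert∈I⇒vert′∈J : ∀ i → vert C i ∈ I → vert′ i ∈ J
    vert∈I⇒vert′∈J i i∈I with vert′-cases i
    ... | inj₁ (_ , i≡to) = subst (_∈ J) (sym i≡to) to∈J
    ... | inj₂ (i≢p , i≡vi) = subst (_∈ J) (sym i≡vi) (∈I⇒∈J (≢p⇒≢from p≡from i≢p) i∈I)

    bad′ : Bad G J C′
    bad′ = induced , alternates
      where
      to~⇒∉I : ∀ {j} → j ≢ p → Adj G to (vert C j) → vert C j ∉ I
      to~⇒∉I j≢p to~j j∈I = J-independent _ _ to∈J (∈I⇒∈J (≢p⇒≢from p≡from j≢p) j∈I) to~j
      induced : Induced G C′
      induced i j i~j with vert′-cases i | vert′-cases j
      ... | inj₁ (_ , i≡to) | inj₁ (_ , j≡to) = ⊥-elim (Adj-irrefl (subst₂ (Adj G) i≡to j≡to i~j))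
      ... | inj₁ (refl , i≡to) | inj₂ (j≢p , j≡vj) =
            let to~j = subst₂ (Adj G) i≡to j≡vj i~j in to~B⇒beside-from p≡from (to~⇒∉I j≢p to~j) to~j
      ... | inj₂ (i≢p , i≡vi) | inj₁ (refl , j≡to) =
            let to~i = Adj-sym (subst₂ (Adj G) i≡vi j≡to i~j)
            in swap (to~B⇒beside-from p≡from (to~⇒∉I i≢p to~i) to~i)
      ... | inj₂ (_ , i≡vi) | inj₂ (_ , j≡vj) = proj₁ bad i j (subst₂ (Adj G) i≡vi j≡vj i~j)
      alternates : ∀ i j → CycSucc (k C) i j →
        (vert′ i ∈ J × vert′ j ∉ J) ⊎ (vert′ i ∉ J × vert′ j ∈ J)
      alternates i j i→j with proj₂ bad i j i→j
      ... | inj₁ (i∈I , j∉I) = inj₁ (vert∈I⇒vert′∈J i i∈I , j∉I ∘ vert′∈J⇒vert∈I j)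
      ... | inj₂ (i∉I , j∈I) = inj₂ (i∉I ∘ vert′∈J⇒vert∈I i , vert∈I⇒vert′∈J j j∈I)

    private
      module OnC′ = OnCycle C′

      ∈V′⁻ : ∀ {x} → x ∈ V G C′ → (x ∈ V G C × x ≢ from) ⊎ x ≡ to
      ∈V′⁻ x∈V′ with OnC′.∈V⁻ x∈V′
      ... | i , i≡x with vert′-cases i
      ...   | inj₁ (_ , i≡to) = inj₂ (trans (sym i≡x) i≡to)
      ...   | inj₂ (i≢p , i≡vi) = inj₁ (subst (_∈ V G C) (trans (sym i≡vi) i≡x) (vert∈V i) ,
                                    λ x≡from → ≢p⇒≢from p≡from i≢p (trans (trans (sym i≡vi) i≡x) x≡from))

      to∈V′ : to ∈ V G C′
      to∈V′ = subst (_∈ V G C′) vert′-p (OnC′.vert∈V p)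

      ∈V⇒∈V′ : ∀ {x} → x ∈ V G C → x ≢ from → x ∈ V G C′
      ∈V⇒∈V′ x∈V x≢from with ∈V⁻ x∈V
      ... | i , refl with vert′-cases i
      ...   | inj₁ (refl , _) = ⊥-elim (x≢from p≡from)
      ...   | inj₂ (_ , i≡vi) = subst (_∈ V G C′) i≡vi (OnC′.vert∈V i)

      ∉I⇒≢from : ∀ {x} → x ∉ I → x ≢ from
      ∉I⇒≢from x∉I refl = x∉I from∈I

      B′⊆B : partB G J C′ ⊆ partB G I C
      B′⊆B {x} x∈ with x∈p─q⁻ (V G C′) J x∈
      ... | x∈V′ , x∉J with ∈V′⁻ x∈V′
      ...   | inj₁ (x∈V , x≢from) = x∈p─q⁺ (V G C) I x∈V (x∉J ∘ ∈I⇒∈J x≢from)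
      ...   | inj₂ refl = ⊥-elim (x∉J to∈J)

      B⊆B′ : partB G I C ⊆ partB G J C′
      B⊆B′ {x} x∈ with x∈p─q⁻ (V G C) I x∈
      ... | x∈V , x∉I = x∈p─q⁺ (V G C′) J (∈V⇒∈V′ x∈V (∉I⇒≢from x∉I))
              (x∉I ∘ ∈J⇒∈I (λ x≡to → to∉V (subst (_∈ V G C) x≡to x∈V)))

    partB-C′ : partB G J C′ ≡ partB G I C
    partB-C′ = ⊆-antisym B′⊆B B⊆B′

    Δ-C′ : J Δ V G C′ ≡ I Δ V G C
    Δ-C′ = ⊆-antisym Δ′⊆Δ Δ⊆Δ′
      where
      Δ′⊆Δ : J Δ V G C′ ⊆ I Δ V G C
      Δ′⊆Δ {x} x∈ with x∈pΔq⁻ J (V G C′) x∈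
      ... | inj₂ (x∈V′ , x∉J) = x∈p∪q⁺ (inj₂ (B′⊆B (x∈p─q⁺ (V G C′) J x∈V′ x∉J)))
      ... | inj₁ (x∈J , x∉V′) with x ≟ to
      ...   | yes refl = ⊥-elim (x∉V′ to∈V′)
      ...   | no x≢to =
              x∈pΔq⁺ˡ I (V G C) (∈J⇒∈I x≢to x∈J) (λ x∈V → x∉V′ (∈V⇒∈V′ x∈V (∈J⇒≢from x∈J)))
      Δ⊆Δ′ : I Δ V G C ⊆ J Δ V G C′
      Δ⊆Δ′ {x} x∈ with x∈pΔq⁻ I (V G C) x∈
      ... | inj₂ (x∈V , x∉I) = x∈p∪q⁺ (inj₂ (B⊆B′ (x∈p─q⁺ (V G C) I x∈V x∉I)))
      ... | inj₁ (x∈I , x∉V) = x∈pΔq⁺ˡ J (V G C′) (∈I⇒∈J x≢from x∈I) x∉V′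
        where
        x≢from : x ≢ from
        x≢from x≡from = x∉V (subst (_∈ V G C) (trans p≡from (sym x≡from)) (vert∈V p))
        x∉V′ : x ∉ V G C′
        x∉V′ x∈V′ with ∈V′⁻ x∈V′
        ... | inj₁ (x∈V , _) = x∉V x∈V
        ... | inj₂ refl = to∉I x∈I

  module Reversal (C : Cycle G) where
    open OnCycle C

    reverse : Cycle G
    reverse = record
      { k = k C ; 3≤k = 3≤k C ; vert = vert C ∘ opposite
      ; inj = λ {i} {j} e → trans (sym (opposite-involutive i))
                              (trans (cong opposite (inj C e)) (opposite-involutive j))
      ; edges = λ i j i→j → Adj-sym (edges C _ _ (cycSucc-opposite i→j)) }

    bad-reverse : ∀ {I} → Bad G I C → Bad G I reverse
    bad-reverse {I} (induced , alternates) = induced′ , alternates′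
      where
      induced′ : Induced G reverse
      induced′ i j i~j with induced (opposite i) (opposite j) i~j
      ... | inj₁ i→j = inj₂ (cycSucc-opposite⁻ i→j)
      ... | inj₂ j→i = inj₁ (cycSucc-opposite⁻ j→i)
      alternates′ : ∀ i j → CycSucc (k C) i j →
        (vert reverse i ∈ I × vert reverse j ∉ I) ⊎ (vert reverse i ∉ I × vert reverse j ∈ I)
      alternates′ i j i→j with alternates _ _ (cycSucc-opposite i→j)
      ... | inj₁ (j∈I , i∉I) = inj₂ (i∉I , j∈I)
      ... | inj₂ (j∉I , i∈I) = inj₁ (i∈I , j∉I)

    V-reverse : V G reverse ≡ V G C
    V-reverse = ⊆-antisym
      (λ x∈ → let i , i≡x = OnCycle.∈V⁻ reverse x∈ in subst (_∈ V G C) i≡x (vert∈V (opposite i)))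
      (λ x∈ → let i , i≡x = ∈V⁻ x∈ in
        subst (_∈ V G reverse) (trans (cong (vert C) (opposite-involutive i)) i≡x)
          (OnCycle.vert∈V reverse (opposite i)))

    vert-reverse-next : ∀ i → vert reverse (next (opposite i)) ≡ vert C (prev i)
    vert-reverse-next i = cong (vert C) (trans
      (cong opposite (cycSucc-functional (cycSucc-next (opposite i)) (cycSucc-opposite (cycSucc-prev i))))
      (opposite-involutive (prev i)))

    vert-reverse-prev : ∀ i → vert reverse (prev (opposite i)) ≡ vert C (next i)
    vert-reverse-prev i = cong (vert C) (trans
      (cong opposite (cycSucc-injective (cycSucc-prev (opposite i)) (cycSucc-opposite (cycSucc-next i))))
      (opposite-involutive (next i)))

  module Rotation (cf : ClawFree G) {I J : Subset n} (m : TSMove G I J)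
                  (C : Cycle G) (bad : Bad G I C) {p : Fin (k C)}
                  (p≡from : vert C p ≡ Move.from m)
                  (to≁next : ¬ Adj G (Move.to m) (vert C (CyclicOrder.next (3≤k C) p)))
                  (to~prev : Adj G (Move.to m) (vert C (CyclicOrder.prev (3≤k C) p))) where
    open Move m
    open OnCycle C
    open BadCycle cf I-independent C bad
    open MoveAtBadCycle cf m C bad
    open Offsets p

    forward-parity : ∀ t → vert C (forward (t + t)) ∈ I × vert C (forward (suc (t + t))) ∉ I
    forward-parity zero = 0∈I , ∈I⇒neighbour∉I (inj₁ (forward-cycSucc 0)) 0∈I
      where
      0∈I : vert C (forward 0) ∈ I
      0∈I = subst (λ i → vert C i ∈ I) (sym forward-0) (p∈I p≡from)
    forward-parity (suc t) = 2t+2∈I , ∈I⇒neighbour∉I (inj₁ (forward-cycSucc (suc t + suc t))) 2t+2∈I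
      where
      2t+2∈I : vert C (forward (suc t + suc t)) ∈ I
      2t+2∈I = subst (λ o → vert C (forward o) ∈ I) (cong suc (sym (+-suc t t)))
        (∉I⇒neighbour∈I (inj₁ (forward-cycSucc (suc (t + t)))) (proj₂ (forward-parity t)))

    offset≡⇒≡forward : ∀ {j o} → offset j ≡ o → j ≡ forward o
    offset≡⇒≡forward {j} offset≡o = trans (sym (forward-offset j)) (cong forward offset≡o)

    ∉I⇒offset≢even : ∀ {j} t → vert C j ∉ I → offset j ≢ t + t
    ∉I⇒offset≢even {j} t j∉I offset≡2t =
      j∉I (subst (λ i → vert C i ∈ I) (sym (offset≡⇒≡forward offset≡2t)) (proj₁ (forward-parity t)))

    ∈I⇒offset≢odd : ∀ {j} t → vert C j ∈ I → offset j ≢ suc (t + t)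
    ∈I⇒offset≢odd {j} t j∈I offset≡2t+1 =
      proj₂ (forward-parity t) (subst (λ i → vert C i ∈ I) (offset≡⇒≡forward offset≡2t+1) j∈I)

    k-even : ∃ λ t → k C ≡ suc (suc (t + t))
    k-even with even⊎odd (k C ∸ 1)
    ... | inj₁ (t , k-1≡2t) = ⊥-elim (∈I⇒neighbour∉I (inj₂ (cycSucc-prev p)) (p∈I p≡from)
            (subst (λ o → vert C (forward o) ∈ I) (sym k-1≡2t) (proj₁ (forward-parity t))))
    ... | inj₂ (t , k-1≡2t+1) =
          t , trans (sym (m+[n∸m]≡n (≤-trans (s≤s z≤n) (3≤k C)))) (cong suc k-1≡2t+1)

    -- After s slides, the tokens of I at offsets 2, 4, …, 2s from p have moved back to
    -- offsets 1, 3, …, 2s − 1, and the token taken from p waits at to.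
    TokenOnCycle : ℕ → Fin (k C) → Set
    TokenOnCycle s j = (vert C j ∉ I × offset j < s + s) ⊎ (vert C j ∈ I × suc (suc (s + s)) ≤ offset j)

    Token : ℕ → Fin n → Set
    Token s x = (x ∈ I × x ∉ V G C) ⊎ (x ≡ to) ⊎ (∃ λ j → vert C j ≡ x × TokenOnCycle s j)

    token? : ∀ s → Decidable (Token s)
    token? s x = ((x ∈? I) ×-dec ¬? (x ∈? V G C)) ⊎-dec (x ≟ to) ⊎-dec any? λ j →
      (vert C j ≟ x) ×-dec ((¬? (vert C j ∈? I) ×-dec (offset j <? s + s)) ⊎-dec
                            ((vert C j ∈? I) ×-dec (suc (suc (s + s)) ≤? offset j)))

    stage : ℕ → Subset n
    stage s = subsetOf (token? s)

    ∈stage⁻ : ∀ s {x} → x ∈ stage s → Token s x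
    ∈stage⁻ s = ∈-subsetOf⁻ (token? s)

    ∈stage⁺ : ∀ s {x} → Token s x → x ∈ stage s
    ∈stage⁺ s = ∈-subsetOf⁺ (token? s)

    from∈V : from ∈ V G C
    from∈V = subst (_∈ V G C) p≡from (vert∈V p)

    0<offset⇒≢from : ∀ {j} → 0 < offset j → vert C j ≢ from
    0<offset⇒≢from {j} 0<offset j≡from =
      <⇒≢ 0<offset (sym (trans (cong offset (inj C (trans j≡from (sym p≡from)))) offset-origin))

    stage-0 : stage 0 ≡ J
    stage-0 = ⊆-antisym stage-0⊆J J⊆stage-0
      where
      stage-0⊆J : stage 0 ⊆ J
      stage-0⊆J x∈ with ∈stage⁻ 0 x∈
      ... | inj₁ (x∈I , x∉V) = ∈I⇒∈J (λ { refl → x∉V from∈V }) x∈I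
      ... | inj₂ (inj₁ refl) = to∈J
      ... | inj₂ (inj₂ (j , refl , inj₁ (_ , ())))
      ... | inj₂ (inj₂ (j , refl , inj₂ (j∈I , 2≤offset))) =
            ∈I⇒∈J (0<offset⇒≢from (≤-trans (s≤s z≤n) 2≤offset)) j∈I
      J⊆stage-0 : J ⊆ stage 0
      J⊆stage-0 {x} x∈J with x ≟ to
      ... | yes refl = ∈stage⁺ 0 (inj₂ (inj₁ refl))
      ... | no x≢to with x ∈? V G C
      ...   | no x∉V = ∈stage⁺ 0 (inj₁ (∈J⇒∈I x≢to x∈J , x∉V))
      ...   | yes x∈V with ∈V⁻ x∈V
      ...     | j , refl = ∈stage⁺ 0 (inj₂ (inj₂ (j , refl , inj₂ (j∈I ,
                 n≤m∧m≢n∧m≢1+n⇒2+n≤m z≤n offset≢0 (∈I⇒offset≢odd 0 j∈I)))))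
        where
        j∈I = ∈J⇒∈I x≢to x∈J
        offset≢0 : offset j ≢ 0
        offset≢0 offset≡0 =
          ∈J⇒≢from x∈J (trans (cong (vert C) (trans (offset≡⇒≡forward offset≡0) forward-0)) p≡from)

    I─V≁token : ∀ s {x y} → x ∈ I → x ∉ V G C → Token s y → ¬ Adj G x y
    I─V≁token _ x∈I _ (inj₁ (y∈I , _)) = I-independent _ _ x∈I y∈I
    I─V≁token _ x∈I x∉V (inj₂ (inj₁ refl)) = J-independent _ _ (∈I⇒∈J (λ { refl → x∉V from∈V }) x∈I) to∈J
    I─V≁token _ x∈I x∉V (inj₂ (inj₂ (j , refl , inj₁ (j∉I , _)))) = B≁I─V j∉I x∈I x∉V ∘ Adj-sym
    I─V≁token _ x∈I _ (inj₂ (inj₂ (j , refl , inj₂ (j∈I , _)))) = I-independent _ _ x∈I j∈I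

    to≁token : ∀ s {y} → s + s < k C → Token s y → ¬ Adj G to y
    to≁token s _ (inj₁ (y∈I , y∉V)) = I─V≁token s y∈I y∉V (inj₂ (inj₁ refl)) ∘ Adj-sym
    to≁token _ _ (inj₂ (inj₁ refl)) = Adj-irrefl
    to≁token _ _ (inj₂ (inj₂ (j , refl , inj₂ (j∈I , 2s+2≤offset)))) =
      J-independent _ _ to∈J (∈I⇒∈J (0<offset⇒≢from (≤-trans (s≤s z≤n) 2s+2≤offset)) j∈I)
    to≁token _ 2s<k (inj₂ (inj₂ (j , refl , inj₁ (j∉I , offset<2s)))) to~j
      with to~B⇒beside-from p≡from j∉I to~j
    ... | inj₁ p→j =
          to≁next (subst (λ i → Adj G to (vert C i)) (sym (cycSucc-functional (cycSucc-next p) p→j)) to~j)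
    ... | inj₂ j→p with offset-cycSucc j→p
    ...   | inj₁ 1+offset≡0 = 1+n≢0 (trans 1+offset≡0 offset-origin)
    ...   | inj₂ (1+offset≡k , _) = <⇒≢ (≤-<-trans offset<2s 2s<k) 1+offset≡k

    tokens-not-consecutive : ∀ s {i j} → TokenOnCycle s i → TokenOnCycle s j → ¬ CycSucc (k C) i j
    tokens-not-consecutive _ (inj₁ (i∉I , _)) (inj₁ (j∉I , _)) i→j = j∉I (∉I⇒neighbour∈I (inj₁ i→j) i∉I)
    tokens-not-consecutive _ (inj₂ (i∈I , _)) (inj₂ (j∈I , _)) i→j = ∈I⇒neighbour∉I (inj₁ i→j) i∈I j∈I
    tokens-not-consecutive _ (inj₁ (_ , offset<2s)) (inj₂ (_ , 2s+2≤offset)) i→j with offset-cycSucc i→j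
    ... | inj₁ 1+i≡j =
          <⇒≱ offset<2s (≤-pred (subst (_ ≤_) (sym 1+i≡j) (≤-trans (n≤1+n _) 2s+2≤offset)))
    ... | inj₂ (_ , j≡0) = <⇒≱ (s≤s z≤n) (subst (_ ≤_) j≡0 2s+2≤offset)
    tokens-not-consecutive s (inj₂ (_ , 2s+2≤offset)) (inj₁ (j∉I , offset<2s)) i→j with offset-cycSucc i→j
    ... | inj₁ 1+i≡j =
          <⇒≱ offset<2s (≤-trans (m≤n+m (s + s) 3) (≤-trans (s≤s 2s+2≤offset) (≤-reflexive 1+i≡j)))
    ... | inj₂ (_ , j≡0) = ∉I⇒offset≢even 0 j∉I j≡0

    stage-independent : ∀ s → s + s < k C → Independent G (stage s)
    stage-independent s 2s<k x y x∈ y∈ = token-independent (∈stage⁻ s x∈) (∈stage⁻ s y∈)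
      where
      token-independent : ∀ {x y} → Token s x → Token s y → ¬ Adj G x y
      token-independent (inj₁ (x∈I , x∉V)) y-token = I─V≁token s x∈I x∉V y-token
      token-independent (inj₂ (inj₁ refl)) y-token = to≁token s 2s<k y-token
      token-independent x-token (inj₁ (y∈I , y∉V)) = I─V≁token s y∈I y∉V x-token ∘ Adj-sym
      token-independent x-token (inj₂ (inj₁ refl)) = to≁token s 2s<k x-token ∘ Adj-sym
      token-independent (inj₂ (inj₂ (i , refl , i-token))) (inj₂ (inj₂ (j , refl , j-token))) i~j
        with proj₁ bad i j i~j
      ... | inj₁ i→j = tokens-not-consecutive s i-token j-token i→j
      ... | inj₂ j→i = tokens-not-consecutive s j-token i-token j→i

    double-suc : ∀ s → suc s + suc s ≡ suc (suc (s + s))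
    double-suc s = cong suc (+-suc s s)

    slider target : ℕ → Fin (k C)
    slider s = forward (suc (suc (s + s)))
    target s = forward (suc (s + s))

    slider∈I : ∀ s → vert C (slider s) ∈ I
    slider∈I s = subst (λ o → vert C (forward o) ∈ I) (double-suc s) (proj₁ (forward-parity (suc s)))

    target∉I : ∀ s → vert C (target s) ∉ I
    target∉I s = proj₂ (forward-parity s)

    vert∈stage⁻ : ∀ s {j} → vert C j ∈ stage s → TokenOnCycle s j
    vert∈stage⁻ s {j} j∈ with ∈stage⁻ s j∈
    ... | inj₁ (_ , j∉V) = ⊥-elim (j∉V (vert∈V j))
    ... | inj₂ (inj₁ j≡to) = ⊥-elim (vert≢to j j≡to)
    ... | inj₂ (inj₂ (i , i≡j , i-token)) = subst (TokenOnCycle s) (inj C i≡j) i-token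

    stage-grow : ∀ s {x} → x ≢ vert C (slider s) → x ∈ stage s → x ∈ stage (suc s)
    stage-grow s {x} x≢slider x∈ with ∈stage⁻ s x∈
    ... | inj₁ x-token = ∈stage⁺ (suc s) (inj₁ x-token)
    ... | inj₂ (inj₁ x≡to) = ∈stage⁺ (suc s) (inj₂ (inj₁ x≡to))
    ... | inj₂ (inj₂ (j , refl , inj₁ (j∉I , offset<2s))) = ∈stage⁺ (suc s) (inj₂ (inj₂ (j , refl ,
          inj₁ (j∉I , ≤-trans offset<2s (+-mono-≤ (n≤1+n s) (n≤1+n s))))))
    ... | inj₂ (inj₂ (j , refl , inj₂ (j∈I , 2s+2≤offset))) = ∈stage⁺ (suc s) (inj₂ (inj₂ (j , refl ,
          inj₂ (j∈I , subst (λ o → suc (suc o) ≤ offset j) (sym (double-suc s))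
            (n≤m∧m≢n∧m≢1+n⇒2+n≤m 2s+2≤offset (x≢slider ∘ cong (vert C) ∘ offset≡⇒≡forward)
              (∈I⇒offset≢odd (suc s) j∈I ∘ λ e → trans e (cong suc (sym (double-suc s)))))))))

    stage-shrink : ∀ s {x} → x ≢ vert C (target s) → x ∈ stage (suc s) → x ∈ stage s
    stage-shrink s {x} x≢target x∈ with ∈stage⁻ (suc s) x∈
    ... | inj₁ x-token = ∈stage⁺ s (inj₁ x-token)
    ... | inj₂ (inj₁ x≡to) = ∈stage⁺ s (inj₂ (inj₁ x≡to))
    ... | inj₂ (inj₂ (j , refl , inj₁ (j∉I , offset<2s+2))) = ∈stage⁺ s (inj₂ (inj₂ (j , refl ,
          inj₁ (j∉I , m<2+n∧m≢1+n∧m≢n⇒m<n (subst (offset j <_) (double-suc s) offset<2s+2)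
            (x≢target ∘ cong (vert C) ∘ offset≡⇒≡forward) (∉I⇒offset≢even s j∉I)))))
    ... | inj₂ (inj₂ (j , refl , inj₂ (j∈I , 2s+4≤offset))) = ∈stage⁺ s (inj₂ (inj₂ (j , refl ,
          inj₂ (j∈I , ≤-trans (≤-trans (≤-reflexive (sym (double-suc s))) (m≤n+m _ 2)) 2s+4≤offset))))

    stage-move : ∀ s → suc (suc (s + s)) < k C → TSMove G (stage s) (stage (suc s))
    stage-move s 2s+2<k = tsMove (stage-independent s 2s<k) (stage-independent (suc s) 2s+2<k′)
      (Adj-sym (edges C _ _ (forward-cycSucc (suc (s + s)))))
      slider∈ slider∉ target∉ target∈ (λ x≢slider _ → stage-grow s x≢slider) (λ _ → stage-shrink s)
      where
      2s+1<k : suc (s + s) < k C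
      2s+1<k = ≤-trans (n≤1+n _) 2s+2<k
      2s<k : s + s < k C
      2s<k = ≤-trans (n≤1+n _) 2s+1<k
      2s+2<k′ : suc s + suc s < k C
      2s+2<k′ = subst (_< k C) (sym (double-suc s)) 2s+2<k
      offset-slider : offset (slider s) ≡ suc (suc (s + s))
      offset-slider = offset-forward 2s+2<k
      offset-target : offset (target s) ≡ suc (s + s)
      offset-target = offset-forward 2s+1<k
      slider∈ : vert C (slider s) ∈ stage s
      slider∈ = ∈stage⁺ s (inj₂ (inj₂ (_ , refl , inj₂ (slider∈I s , ≤-reflexive (sym offset-slider)))))
      slider∉ : vert C (slider s) ∉ stage (suc s)
      slider∉ slider∈′ with vert∈stage⁻ (suc s) slider∈′
      ... | inj₁ (slider∉I , _) = slider∉I (slider∈I s)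
      ... | inj₂ (_ , 2s+4≤offset) = <⇒≱ (s≤s (s≤s (s≤s (+-monoʳ-≤ s (n≤1+n s)))))
              (≤-trans 2s+4≤offset (≤-reflexive offset-slider))
      target∉ : vert C (target s) ∉ stage s
      target∉ target∈′ with vert∈stage⁻ s target∈′
      ... | inj₁ (_ , offset<2s) = <⇒≱ offset<2s (≤-trans (n≤1+n _) (≤-reflexive (sym offset-target)))
      ... | inj₂ (target∈I , _) = target∉I s target∈I
      target∈ : vert C (target s) ∈ stage (suc s)
      target∈ = ∈stage⁺ (suc s) (inj₂ (inj₂ (_ , refl , inj₁ (target∉I s ,
        subst₂ _<_ (sym offset-target) (sym (double-suc s)) (n<1+n _)))))

    stages : ∀ s → suc (suc (s + s)) ≤ k C → _↔TS_ G (stage 0) (stage s)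
    stages zero _ = ε
    stages (suc s) 2s+4≤k = stages s (≤-trans (n≤1+n _) 2s+2<k) ◅◅ (stage-move s 2s+2<k ◅ ε)
      where
      2s+2<k : suc (suc (s + s)) < k C
      2s+2<k = ≤-trans (n≤1+n _) (subst (λ o → suc (suc o) ≤ k C) (double-suc s) 2s+4≤k)

    final-move : ∀ t → k C ≡ suc (suc (t + t)) → TSMove G (stage t) (I Δ V G C)
    final-move t k≡2t+2 = tsMove (stage-independent t 2t<k) Δ-independent to~target
      (∈stage⁺ t (inj₂ (inj₁ refl))) to∉Δ target∉ (x∈pΔq⁺ʳ I (V G C) (vert∈V _) (target∉I t))
      stage⊆Δ Δ⊆stage
      where
      2t+1<k : suc (t + t) < k C
      2t+1<k = ≤-reflexive (sym k≡2t+2)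
      2t<k : t + t < k C
      2t<k = ≤-trans (n≤1+n _) 2t+1<k
      to~target : Adj G to (vert C (target t))
      to~target = subst (λ o → Adj G to (vert C (forward o))) (cong (_∸ 1) k≡2t+2) to~prev
      to∉Δ : to ∉ I Δ V G C
      to∉Δ to∈ with x∈pΔq⁻ I (V G C) to∈
      ... | inj₁ (to∈I , _) = to∉I to∈I
      ... | inj₂ (to∈V , _) = to∉V to∈V
      target∉ : vert C (target t) ∉ stage t
      target∉ target∈ with vert∈stage⁻ t target∈
      ... | inj₁ (_ , offset<2t) =
            <⇒≱ offset<2t (≤-trans (n≤1+n _) (≤-reflexive (sym (offset-forward 2t+1<k))))
      ... | inj₂ (target∈I , _) = target∉I t target∈I
      stage⊆Δ : ∀ {x} → x ≢ to → x ≢ vert C (target t) → x ∈ stage t → x ∈ I Δ V G C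
      stage⊆Δ x≢to _ x∈ with ∈stage⁻ t x∈
      ... | inj₁ (x∈I , x∉V) = x∈pΔq⁺ˡ I (V G C) x∈I x∉V
      ... | inj₂ (inj₁ x≡to) = ⊥-elim (x≢to x≡to)
      ... | inj₂ (inj₂ (j , refl , inj₁ (j∉I , _))) = x∈pΔq⁺ʳ I (V G C) (vert∈V j) j∉I
      ... | inj₂ (inj₂ (j , refl , inj₂ (_ , k≤offset))) =
            ⊥-elim (<⇒≱ (offset<k j) (≤-trans (≤-reflexive k≡2t+2) k≤offset))
      Δ⊆stage : ∀ {x} → x ≢ to → x ≢ vert C (target t) → x ∈ I Δ V G C → x ∈ stage t
      Δ⊆stage x≢to x≢target x∈ with x∈pΔq⁻ I (V G C) x∈
      ... | inj₁ x-token = ∈stage⁺ t (inj₁ x-token)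
      ... | inj₂ (x∈V , x∉I) with ∈V⁻ x∈V
      ...   | j , refl = ∈stage⁺ t (inj₂ (inj₂ (j , refl , inj₁ (x∉I ,
              m<2+n∧m≢1+n∧m≢n⇒m<n (subst (offset j <_) k≡2t+2 (offset<k j))
                (x≢target ∘ cong (vert C) ∘ offset≡⇒≡forward) (∉I⇒offset≢even t x∉I)))))

    rotate : _↔TS_ G J (I Δ V G C)
    rotate with k-even
    ... | t , k≡2t+2 = subst (λ S → _↔TS_ G S (stage t)) stage-0 (stages t (≤-reflexive (sym k≡2t+2)))
                       ◅◅ (final-move t k≡2t+2 ◅ ε)

  Flippable : Subset n → Subset n → Set
  Flippable L I = ∀ C → Bad G I C → Acyclic G (L ∪ partB G I C) → _↔TS_ G I (I Δ V G C)

  flippable-at-end : ∀ {I} → Flippable I I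
  flippable-at-end {I} C _ acyclic = ⊥-elim (acyclic (C , V⊆I∪B))
    where
    V⊆I∪B : ∀ i → vert C i ∈ I ∪ partB G I C
    V⊆I∪B i with vert C i ∈? I
    ... | yes i∈I = x∈p∪q⁺ (inj₁ i∈I)
    ... | no i∉I = x∈p∪q⁺ (inj₂ (x∈p─q⁺ (V G C) I (OnCycle.vert∈V C i) i∉I))

  module _ (cf : ClawFree G) where

    module FlippableBeforeMove {I J L : Subset n} (m : TSMove G I J) (flip-J : Flippable L J)
                               (C : Cycle G) (bad : Bad G I C) (acyclic : Acyclic G (L ∪ partB G I C)) where
      open Move m
      open OnCycle C

      acyclic-for : ∀ {B} → B ≡ partB G I C → Acyclic G (L ∪ B)
      acyclic-for B≡ = subst (λ B → Acyclic G (L ∪ B)) (sym B≡) acyclic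

      flip-I : _↔TS_ G I (I Δ V G C)
      flip-I with from ∈? V G C
      ... | no from∉V = m ◅ flip-J C bad-J (acyclic-for partB-J) ◅◅ (move-back ◅ ε)
        where open MoveOffCycle cf m C bad from∉V
      ... | yes from∈V with ∈V⁻ from∈V
      ...   | p , p≡from with Adj? to (vert C (next p)) | Adj? to (vert C (prev p))
      ...     | yes to~next | yes to~prev =
                m ◅ subst (_↔TS_ G J) Δ-C′ (flip-J C′ bad′ (acyclic-for partB-C′))
        where open Substitution cf m C bad p≡from to~next to~prev
      ...     | no to≁next | yes to~prev = m ◅ Rotation.rotate cf m C bad p≡from to≁next to~prev
      ...     | yes to~next | no to≁prev =
                m ◅ subst (λ U → _↔TS_ G J (I Δ U)) V-reverse (Rotation.rotate cf m reverse (bad-reverse bad)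
                  (trans (cong (vert C) (opposite-involutive p)) p≡from)
                  (to≁prev ∘ subst (Adj G to) (vert-reverse-next p))
                  (subst (Adj G to) (sym (vert-reverse-prev p)) to~next))
        where open Reversal C
      ...     | no to≁next | no to≁prev =
                ⊥-elim (MoveAtBadCycle.to-beside-from cf m C bad p≡from (to≁next , to≁prev))

    flippable : ∀ {I L} → _↔TS_ G I L → Flippable L I
    flippable ε = flippable-at-end
    flippable (m ◅ ms) = FlippableBeforeMove.flip-I m (flippable ms)

lemma9 : (G : Graph) → ClawFree G → (I : Subset (Graph.n G)) → Independent G I →
    (C : Cycle G) → Bad G I C → Resolvable G I C →
    _↔TS_ G I (I Δ V G C)
lemma9 G cf I _ C bad (L , _ , I↔L , acyclic) = flippable G cf I↔L C bad acyclic
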